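{- Let $n,r,s$ be positive integers with $r\le n$, $s\le n$, and let $k$ be an integer. Consider an $n\times n$ array in which the cells of $A$, the subarray formed by rows $1,\ldots,r$ and columns $1,\ldots,s$, are filled with zeros and ones, and let $B$ denote the subarray formed by rows $r+1,\ldots,n$ and columns $1,\ldots,s$ (the cells of $B$ are initially unfilled). Suppose that each row of $A$ contains at least $s+k-n$ and at most $k$ ones, and each column of $A$ contains at least $r+k-n$ and at most $k$ ones. Let $a_0$ be the number of ones in $A$. If 1) $(r+s-n)k\le a_0$, and 2) $a_0\le rs-(n-k)(r+s-n)$, then the cells of $B$ can be filled with zeros and ones so that each column of the $n\times s$ array $A\cup B$ (rows $1,\ldots,n$, columns $1,\ldots,s$) contains exactly $k$ ones, and each row of $A\cup B$ contains at least $s+k-n$ and at most $k$ ones. -}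

module Defs where

open import Data.Bool using (Bool; true; false)
open import Data.Nat using (ℕ; zero; suc; _+_)
open import Data.Fin using (Fin)
open import Data.Sum using (inj₁; inj₂)
import Data.Fin as F

ones : {m : ℕ} → (Fin m → Bool) → ℕ
ones {zero} f = 0
ones {suc m} f with f F.zero
... | true  = suc (ones (λ i → f (F.suc i)))
... | false = ones (λ i → f (F.suc i))

-- a 0/1 array with p rows and q columns (true = one, false = zero)
Array : ℕ → ℕ → Set
Array p q = Fin p → Fin q → Bool

rowOnes : {p q : ℕ} → Array p q → Fin p → ℕ
rowOnes M i = ones (M i)

colOnes : {p q : ℕ} → Array p q → Fin q → ℕ
colOnes M j = ones (λ i → M i j)

totalOnes : {p q : ℕ} → Array p q → ℕ
totalOnes {zero} M = 0
totalOnes {suc p} M = rowOnes M F.zero + totalOnes (λ i → M (F.suc i))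

stack : {r m q : ℕ} → Array r q → Array m q → Array (r + m) q
stack {r} A B i j with F.splitAt r i
... | inj₁ i' = A i' j
... | inj₂ i' = B i' j

-- Column j of A still needs d_j = k − (ones of A in column j) ones; the column bounds on A
-- give 0 ≤ d_j ≤ n − r, and hypotheses 1) and 2) say exactly that D = Σ d_j = sk − a₀ lies
-- between (n − r)(s + k − n) and (n − r)k.  Deal D tokens round robin to the n − r rows of B,
-- column j taking the next d_j of them: as d_j ≤ n − r, no row gets two tokens of one column,
-- and every row gets ⌊D/(n − r)⌋ or ⌈D/(n − r)⌉ tokens, which lies between s + k − n and k.

module Submission where

open import Defs
open import Data.Nat using (ℕ; _∸_; NonZero)
import Data.Nat as N
import Data.Nat.Properties as N
open import Algebra.Properties.CommutativeMonoid.Sum N.+-0-commutativeMonoid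
  using (sum; sum-syntax; sum-cong-≗; ∑-distrib-+; ∑-comm)
open import Data.Fin using (Fin)
import Data.Fin as F
open import Data.Product using (Σ; _×_; _,_; proj₁; proj₂)
open import Function using (_∘_)
open import Relation.Binary.PropositionalEquality
open import Relation.Nullary using (yes; no)

module Combinatorics where

  open import Data.Bool using (Bool; true; false)
  open import Data.Empty using (⊥-elim)
  open import Data.Fin using (zero; suc; toℕ; splitAt; join; _↑ˡ_; _↑ʳ_)
  open import Data.Fin.Properties using (splitAt-↑ˡ; splitAt-↑ʳ; join-splitAt)
  open import Data.Nat
  open import Data.Nat.DivMod
  open import Data.Nat.Properties
  open import Data.Sum using (inj₁; inj₂)
  open import Relation.Nullary.Reflects using (ofʸ; ofⁿ)

  indicator : Bool → ℕ
  indicator true  = 1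
  indicator false = 0

  indicator≤1 : ∀ b → indicator b ≤ 1
  indicator≤1 true  = ≤-refl
  indicator≤1 false = z≤n

  indicator-<ᵇ : ∀ {g f} → g ≤ f → f ≤ suc g → indicator (g <ᵇ f) + g ≡ f
  indicator-<ᵇ {g} {f} g≤f f≤1+g with g <ᵇ f | <ᵇ-reflects-< g f
  ... | true  | ofʸ g<f = ≤-antisym g<f f≤1+g
  ... | false | ofⁿ g≮f = ≤-antisym g≤f (≮⇒≥ g≮f)

  indicator-<ᵇ-monoʳ : ∀ t {r r'} → r ≤ r' → indicator (t <ᵇ r) ≤ indicator (t <ᵇ r')
  indicator-<ᵇ-monoʳ t {r} {r'} r≤r' with t <ᵇ r | <ᵇ-reflects-< t r | t <ᵇ r' | <ᵇ-reflects-< t r'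
  ... | false | _       | _     | _        = z≤n
  ... | true  | _       | true  | _        = ≤-refl
  ... | true  | ofʸ t<r | false | ofⁿ t≮r' = ⊥-elim (t≮r' (<-≤-trans t<r r≤r'))

  ∑-const : ∀ m c → ∑[ i < m ] c ≡ m * c
  ∑-const zero    c = refl
  ∑-const (suc m) c = cong (c +_) (∑-const m c)

  ∑-++ : ∀ r {m} (f : Fin (r + m) → ℕ) → sum f ≡ sum (f ∘ (_↑ˡ m)) + sum (f ∘ (r ↑ʳ_))
  ∑-++ zero    f = refl
  ∑-++ (suc r) f = trans (cong (f zero +_) (∑-++ r (f ∘ suc))) (sym (+-assoc (f zero) _ _))

  ones-suc : ∀ {m} (f : Fin (suc m) → Bool) → ones f ≡ indicator (f zero) + ones (f ∘ suc)
  ones-suc f with f zero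
  ... | true  = refl
  ... | false = refl

  ones≡∑indicator : ∀ {m} (f : Fin m → Bool) → ones f ≡ ∑[ i < m ] indicator (f i)
  ones≡∑indicator {zero}  f = refl
  ones≡∑indicator {suc m} f = trans (ones-suc f) (cong (indicator (f zero) +_) (ones≡∑indicator (f ∘ suc)))

  ones-cong : ∀ {m} {f g : Fin m → Bool} → (∀ i → f i ≡ g i) → ones f ≡ ones g
  ones-cong {f = f} {g} f≗g = begin
    ones f                   ≡⟨ ones≡∑indicator f ⟩
    sum (indicator ∘ f)      ≡⟨ sum-cong-≗ (cong indicator ∘ f≗g) ⟩
    sum (indicator ∘ g)      ≡⟨ ones≡∑indicator g ⟨
    ones g                   ∎
    where open ≡-Reasoning

  ones-++ : ∀ r {m} (f : Fin (r + m) → Bool) → ones f ≡ ones (f ∘ (_↑ˡ m)) + ones (f ∘ (r ↑ʳ_))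
  ones-++ r {m} f = begin
    ones f                                                          ≡⟨ ones≡∑indicator f ⟩
    sum (indicator ∘ f)                                             ≡⟨ ∑-++ r (indicator ∘ f) ⟩
    sum (indicator ∘ f ∘ (_↑ˡ m)) + sum (indicator ∘ f ∘ (r ↑ʳ_))   ≡⟨ cong₂ _+_ (ones≡∑indicator (f ∘ (_↑ˡ m)))
                                                                                 (ones≡∑indicator (f ∘ (r ↑ʳ_))) ⟨
    ones (f ∘ (_↑ˡ m)) + ones (f ∘ (r ↑ʳ_))                         ∎
    where open ≡-Reasoning

  ones-false : ∀ m → ones {m} (λ _ → false) ≡ 0
  ones-false zero    = refl
  ones-false (suc m) = ones-false m

  ones-toℕ<ᵇ : ∀ {m} r → r ≤ m → ones {m} (λ i → toℕ i <ᵇ r) ≡ r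
  ones-toℕ<ᵇ {m}     zero    _         = ones-false m
  ones-toℕ<ᵇ {suc m} (suc r) (s≤s r≤m) = cong suc (ones-toℕ<ᵇ r r≤m)

  totalOnes≡∑rowOnes : ∀ {p q} (M : Array p q) → totalOnes M ≡ sum (rowOnes M)
  totalOnes≡∑rowOnes {zero}  M = refl
  totalOnes≡∑rowOnes {suc p} M = cong (rowOnes M zero +_) (totalOnes≡∑rowOnes (M ∘ suc))

  totalOnes≡∑colOnes : ∀ {p q} (M : Array p q) → totalOnes M ≡ sum (colOnes M)
  totalOnes≡∑colOnes {p} {q} M = begin
    totalOnes M                                      ≡⟨ totalOnes≡∑rowOnes M ⟩
    ∑[ i < p ] ones (M i)                            ≡⟨ sum-cong-≗ (ones≡∑indicator ∘ M) ⟩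
    ∑[ i < p ] ∑[ j < q ] indicator (M i j)          ≡⟨ ∑-comm (λ i j → indicator (M i j)) ⟩
    ∑[ j < q ] ∑[ i < p ] indicator (M i j)          ≡⟨ sum-cong-≗ (λ j → ones≡∑indicator (λ i → M i j)) ⟨
    sum (colOnes M)                                  ∎
    where open ≡-Reasoning

  module _ {r m q : ℕ} (A : Array r q) (B : Array m q) where

    stack-↑ˡ : ∀ i j → stack A B (i ↑ˡ m) j ≡ A i j
    stack-↑ˡ i j rewrite splitAt-↑ˡ r i m = refl

    stack-↑ʳ : ∀ i j → stack A B (r ↑ʳ i) j ≡ B i j
    stack-↑ʳ i j rewrite splitAt-↑ʳ r m i = refl

    colOnes-stack : ∀ j → colOnes (stack A B) j ≡ colOnes A j + colOnes B j
    colOnes-stack j = trans (ones-++ r (λ i → stack A B i j))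
      (cong₂ _+_ (ones-cong (λ i → stack-↑ˡ i j)) (ones-cong (λ i → stack-↑ʳ i j)))

    stack-rows : (P : ℕ → Set) → (∀ i → P (rowOnes A i)) → (∀ i → P (rowOnes B i)) →
                 ∀ i → P (rowOnes (stack A B) i)
    stack-rows P PA PB i = subst (P ∘ rowOnes (stack A B)) (join-splitAt r m i) (P-join (splitAt r i))
      where
      P-join : ∀ x → P (rowOnes (stack A B) (join r m x))
      P-join (inj₁ i) = subst P (sym (ones-cong (stack-↑ˡ i))) (PA i)
      P-join (inj₂ i) = subst P (sym (ones-cong (stack-↑ʳ i))) (PB i)

  module RoundRobin (M : ℕ) .{{_ : NonZero M}} where

    -- share N i = #{t < N ∣ t ≡ toℕ i (mod M)}: what row i holds once tokens 0, …, N − 1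
    -- have been dealt round robin to the M rows.
    share : ℕ → Fin M → ℕ
    share N i = N / M + indicator (toℕ i <ᵇ N % M)

    ∑-share : ∀ N → sum (share N) ≡ N
    ∑-share N = begin
      sum (share N)                                       ≡⟨ ∑-distrib-+ (λ _ → N / M) (indicator ∘ below) ⟩
      ∑[ i < M ] (N / M) + sum (indicator ∘ below)        ≡⟨ cong (_+ sum (indicator ∘ below)) (∑-const M (N / M)) ⟩
      M * (N / M) + sum (indicator ∘ below)               ≡⟨ cong (M * (N / M) +_) (ones≡∑indicator below) ⟨
      M * (N / M) + ones below                            ≡⟨ cong₂ _+_ (*-comm M (N / M)) (ones-toℕ<ᵇ (N % M) (m%n≤n N M)) ⟩
      N / M * M + N % M                                   ≡⟨ +-comm (N / M * M) (N % M) ⟩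
      N % M + N / M * M                                   ≡⟨ m≡m%n+[m/n]*n N M ⟨
      N                                                   ∎
      where
      open ≡-Reasoning
      below : Fin M → Bool
      below i = toℕ i <ᵇ N % M

    share-exact : ∀ q i → share (q * M) i ≡ q
    share-exact q i = trans (cong₂ _+_ (m*n/n≡m q M) (cong (λ r → indicator (toℕ i <ᵇ r)) (m*n%n≡0 q M)))
                            (+-identityʳ q)

    share-+M : ∀ N i → share (N + M) i ≡ suc (share N i)
    share-+M N i = cong₂ _+_ quotient (cong (λ r → indicator (toℕ i <ᵇ r)) ([m+n]%n≡m%n N M))
      where
      quotient : (N + M) / M ≡ suc (N / M)
      quotient = trans (m/n≡1+[m∸n]/n (m≤n+m M N)) (cong (λ x → suc (x / M)) (m+n∸n≡m N M))

    share-mono : ∀ {N N'} → N ≤ N' → ∀ i → share N i ≤ share N' i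
    share-mono {N} {N'} N≤N' i with m≤n⇒m<n∨m≡n (/-monoˡ-≤ M N≤N')
    ... | inj₁ q<q' = begin
      share N i     ≤⟨ +-monoʳ-≤ (N / M) (indicator≤1 _) ⟩
      N / M + 1     ≡⟨ +-comm (N / M) 1 ⟩
      suc (N / M)   ≤⟨ q<q' ⟩
      N' / M        ≤⟨ m≤m+n (N' / M) _ ⟩
      share N' i    ∎
      where open ≤-Reasoning
    ... | inj₂ q≡q' = +-mono-≤ (≤-reflexive q≡q') (indicator-<ᵇ-monoʳ (toℕ i) r≤r')
      where
      r≤r' : N % M ≤ N' % M
      r≤r' = +-cancelʳ-≤ (N / M * M) (N % M) (N' % M) (begin
        N % M + N / M * M   ≡⟨ m≡m%n+[m/n]*n N M ⟨
        N                   ≤⟨ N≤N' ⟩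
        N'                  ≡⟨ m≡m%n+[m/n]*n N' M ⟩
        N' % M + N' / M * M ≡⟨ cong (λ q → N' % M + q * M) q≡q' ⟨
        N' % M + N / M * M  ∎)
        where open ≤-Reasoning

    share-bounds : ∀ {lo hi N} → lo * M ≤ N → N ≤ hi * M → ∀ i → lo ≤ share N i × share N i ≤ hi
    share-bounds {lo} {hi} lo*M≤N N≤hi*M i =
      subst (_≤ _) (share-exact lo i) (share-mono lo*M≤N i) ,
      subst (_ ≤_) (share-exact hi i) (share-mono N≤hi*M i)

    share-step : ∀ o {d} → d ≤ M → ∀ i → indicator (share o i <ᵇ share (o + d) i) + share o i ≡ share (o + d) i
    share-step o {d} d≤M i = indicator-<ᵇ (share-mono (m≤m+n o d) i)
      (≤-trans (share-mono (+-monoʳ-≤ o d≤M) i) (≤-reflexive (share-+M o i)))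

    -- Column j receives the tokens o + d₀ + ⋯ + d_{j−1}, …, o + d₀ + ⋯ + d_j − 1.
    roundRobin : ∀ {s} → ℕ → (Fin s → ℕ) → Array M s
    roundRobin o d i zero    = share o i <ᵇ share (o + d zero) i
    roundRobin o d i (suc j) = roundRobin (o + d zero) (d ∘ suc) i j

    colOnes-roundRobin : ∀ {s} o (d : Fin s → ℕ) → (∀ j → d j ≤ M) → ∀ j → colOnes (roundRobin o d) j ≡ d j
    colOnes-roundRobin o d d≤M (suc j) = colOnes-roundRobin (o + d zero) (d ∘ suc) (d≤M ∘ suc) j
    colOnes-roundRobin o d d≤M zero    = +-cancelʳ-≡ o _ _ (begin
      ones column + o                                      ≡⟨ cong₂ _+_ (ones≡∑indicator column) (sym (∑-share o)) ⟩
      sum (indicator ∘ column) + sum (share o)             ≡⟨ ∑-distrib-+ (indicator ∘ column) (share o) ⟨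
      ∑[ i < M ] (indicator (column i) + share o i)        ≡⟨ sum-cong-≗ (share-step o (d≤M zero)) ⟩
      sum (share (o + d zero))                             ≡⟨ ∑-share (o + d zero) ⟩
      o + d zero                                           ≡⟨ +-comm o (d zero) ⟩
      d zero + o                                           ∎)
      where
      open ≡-Reasoning
      column : Fin M → Bool
      column i = roundRobin o d i zero

    rowOnes-roundRobin : ∀ {s} o (d : Fin s → ℕ) → (∀ j → d j ≤ M) → ∀ i →
                         rowOnes (roundRobin o d) i + share o i ≡ share (o + sum d) i
    rowOnes-roundRobin {zero}  o d d≤M i = cong (λ x → share x i) (sym (+-identityʳ o))
    rowOnes-roundRobin {suc s} o d d≤M i = begin
      rowOnes (roundRobin o d) i + share o i          ≡⟨ cong (_+ share o i) (ones-suc (roundRobin o d i)) ⟩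
      (first + rest) + share o i                      ≡⟨ cong (_+ share o i) (+-comm first rest) ⟩
      (rest + first) + share o i                      ≡⟨ +-assoc rest first (share o i) ⟩
      rest + (first + share o i)                      ≡⟨ cong (rest +_) (share-step o (d≤M zero) i) ⟩
      rest + share (o + d zero) i                     ≡⟨ rowOnes-roundRobin (o + d zero) (d ∘ suc) (d≤M ∘ suc) i ⟩
      share (o + d zero + sum (d ∘ suc)) i            ≡⟨ cong (λ x → share x i) (+-assoc o (d zero) _) ⟩
      share (o + sum d) i                             ∎
      where
      open ≡-Reasoning
      first rest : ℕ
      first = indicator (roundRobin o d i zero)
      rest  = rowOnes (roundRobin (o + d zero) (d ∘ suc)) i

  arrayWithColumnSums : ∀ m {s} (d : Fin s → ℕ) {lo hi} → (∀ j → d j ≤ m) →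
                        lo * m ≤ sum d → sum d ≤ hi * m →
                        Σ (Array m s) λ B → (∀ j → colOnes B j ≡ d j) × (∀ i → lo ≤ rowOnes B i × rowOnes B i ≤ hi)
  arrayWithColumnSums zero      d d≤0 _ _ = (λ ()) , (λ j → sym (n≤0⇒n≡0 (d≤0 j))) , λ ()
  arrayWithColumnSums m@(suc _) d {lo} {hi} d≤m lo*m≤∑d ∑d≤hi*m =
    roundRobin 0 d , colOnes-roundRobin 0 d d≤m , rows
    where
    open RoundRobin m
    rows : ∀ i → lo ≤ rowOnes (roundRobin 0 d) i × rowOnes (roundRobin 0 d) i ≤ hi
    rows i = subst (λ x → lo ≤ x × x ≤ hi) rowOnes≡share (share-bounds lo*m≤∑d ∑d≤hi*m i)
      where
      rowOnes≡share : share (sum d) i ≡ rowOnes (roundRobin 0 d) i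
      rowOnes≡share = trans (sym (rowOnes-roundRobin 0 d d≤m i))
                            (trans (cong (rowOnes (roundRobin 0 d) i +_) (share-exact 0 i)) (+-identityʳ _))

  deficit : ∀ {p q} → ℕ → Array p q → Fin q → ℕ
  deficit K A j = K ∸ colOnes A j

  m+n≤o+p⇒n∸p≤o∸m : ∀ {m n o p} → m ≤ o → m + n ≤ o + p → n ∸ p ≤ o ∸ m
  m+n≤o+p⇒n∸p≤o∸m {m} {n} {o} {p} m≤o m+n≤o+p = m≤n+o⇒m∸n≤o n p (begin
    n              ≡⟨ m+n∸m≡n m n ⟨
    m + n ∸ m      ≤⟨ ∸-monoˡ-≤ m m+n≤o+p ⟩
    o + p ∸ m      ≡⟨ cong (_∸ m) (+-comm o p) ⟩
    p + o ∸ m      ≡⟨ +-∸-assoc p m≤o ⟩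
    p + (o ∸ m)    ∎)
    where open ≤-Reasoning

  module _ {r q K} (A : Array r q) (colOnes≤K : ∀ j → colOnes A j ≤ K) where

    ∑deficit+totalOnes : sum (deficit K A) + totalOnes A ≡ q * K
    ∑deficit+totalOnes = begin
      sum (deficit K A) + totalOnes A                  ≡⟨ cong (sum (deficit K A) +_) (totalOnes≡∑colOnes A) ⟩
      sum (deficit K A) + sum (colOnes A)              ≡⟨ ∑-distrib-+ (deficit K A) (colOnes A) ⟨
      ∑[ j < q ] (deficit K A j + colOnes A j)         ≡⟨ sum-cong-≗ (λ j → m∸n+n≡m (colOnes≤K j)) ⟩
      ∑[ j < q ] K                                     ≡⟨ ∑-const q K ⟩
      q * K                                            ∎
      where open ≡-Reasoning

    completion : ∀ n {lo} → r ≤ n → (∀ j → r + K ≤ n + colOnes A j) →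
                 lo * (n ∸ r) ≤ sum (deficit K A) → sum (deficit K A) ≤ K * (n ∸ r) →
                 Σ (Array (n ∸ r) q) λ B →
                   (∀ j → colOnes (stack A B) j ≡ K) × (∀ i → lo ≤ rowOnes B i × rowOnes B i ≤ K)
    completion n r≤n colOnes≥ lo*m≤∑d ∑d≤K*m
      with arrayWithColumnSums (n ∸ r) (deficit K A) (λ j → m+n≤o+p⇒n∸p≤o∸m r≤n (colOnes≥ j)) lo*m≤∑d ∑d≤K*m
    ... | B , colOnesB , rowsB = B , colOnes-stack≡K , rowsB
      where
      colOnes-stack≡K : ∀ j → colOnes (stack A B) j ≡ K
      colOnes-stack≡K j = begin
        colOnes (stack A B) j           ≡⟨ colOnes-stack A B j ⟩
        colOnes A j + colOnes B j       ≡⟨ cong (colOnes A j +_) (colOnesB j) ⟩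
        colOnes A j + (K ∸ colOnes A j) ≡⟨ m+[n∸m]≡n (colOnes≤K j) ⟩
        K                               ∎
        where open ≡-Reasoning

open Combinatorics using (deficit; ∑deficit+totalOnes; completion; stack-rows)

open import Data.Integer using (ℤ; +_; -[1+_]; -_; _+_; _-_; _*_; _≤_; +≤+)
import Data.Integer.Properties as ℤ
open import Data.Integer.Tactic.RingSolver using (solve-∀)

m-n≤o⇒m≤n+o : ∀ {m n o} → + m - + n ≤ + o → m N.≤ n N.+ o
m-n≤o⇒m≤n+o {m} {n} {o} m-n≤o = ℤ.drop‿+≤+ (begin
  + m                 ≡⟨ i≡j+[i-j] (+ m) (+ n) ⟩
  + n + (+ m - + n)   ≤⟨ ℤ.+-monoʳ-≤ (+ n) m-n≤o ⟩
  + (n N.+ o)         ∎)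
  where
  open ℤ.≤-Reasoning
  i≡j+[i-j] : ∀ i j → i ≡ j + (i - j)
  i≡j+[i-j] = solve-∀

m≤n+o⇒m-n≤o : ∀ {m n o} → m N.≤ n N.+ o → + m - + n ≤ + o
m≤n+o⇒m-n≤o {m} {n} {o} m≤n+o = begin
  + m - + n           ≤⟨ ℤ.+-monoˡ-≤ (- + n) (+≤+ m≤n+o) ⟩
  + n + + o - + n     ≡⟨ i+j-i≡j (+ n) (+ o) ⟩
  + o                 ∎
  where
  open ℤ.≤-Reasoning
  i+j-i≡j : ∀ i j → i + j - i ≡ j
  i+j-i≡j = solve-∀

pos-∸ : ∀ {m n} → n N.≤ m → + (m ∸ n) ≡ + m - + n
pos-∸ {m} {n} n≤m = sym (trans (ℤ.m-n≡m⊖n m n) (ℤ.⊖-≥ n≤m))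

+m≡+o-+n : ∀ {m n o} → m N.+ n ≡ o → + m ≡ + o - + n
+m≡+o-+n {m} {n} refl = i≡i+j-j (+ m) (+ n)
  where
  i≡i+j-j : ∀ i j → i ≡ i + j - j
  i≡i+j-j = solve-∀

module _ {n r s K a D : ℕ} (r≤n : r N.≤ n) (D+a≡s*K : D N.+ a ≡ s N.* K) where

  ∑deficit-upper : (+ r + + s - + n) * + K ≤ + a → D N.≤ K N.* (n ∸ r)
  ∑deficit-upper lower = ℤ.drop‿+≤+ (begin
    + D                                   ≡⟨ +m≡+o-+n D+a≡s*K ⟩
    + (s N.* K) - + a                     ≡⟨ cong (_- + a) (ℤ.pos-* s K) ⟩
    + s * + K - + a                       ≤⟨ ℤ.+-monoʳ-≤ (+ s * + K) (ℤ.neg-mono-≤ lower) ⟩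
    + s * + K - (+ r + + s - + n) * + K   ≡⟨ identity (+ n) (+ r) (+ s) (+ K) ⟩
    + K * (+ n - + r)                     ≡⟨ cong (+ K *_) (pos-∸ r≤n) ⟨
    + K * + (n ∸ r)                       ≡⟨ ℤ.pos-* K (n ∸ r) ⟨
    + (K N.* (n ∸ r))                     ∎)
    where
    open ℤ.≤-Reasoning
    identity : ∀ n r s K → s * K - (r + s - n) * K ≡ K * (n - r)
    identity = solve-∀

  ∑deficit-lower : + a ≤ + r * + s - (+ n - + K) * (+ r + + s - + n) → (s N.+ K ∸ n) N.* (n ∸ r) N.≤ D
  ∑deficit-lower upper with s N.+ K N.≤? n
  ... | yes s+K≤n = subst (λ x → x N.* (n ∸ r) N.≤ D) (sym (N.m≤n⇒m∸n≡0 s+K≤n)) N.z≤n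
  ... | no  s+K≰n = ℤ.drop‿+≤+ (begin
    + ((s N.+ K ∸ n) N.* (n ∸ r))                                ≡⟨ ℤ.pos-* (s N.+ K ∸ n) (n ∸ r) ⟩
    + (s N.+ K ∸ n) * + (n ∸ r)                                  ≡⟨ cong₂ _*_ (pos-∸ (N.<⇒≤ (N.≰⇒> s+K≰n))) (pos-∸ r≤n) ⟩
    (+ s + + K - + n) * (+ n - + r)                              ≡⟨ identity (+ n) (+ r) (+ s) (+ K) ⟩
    + s * + K - (+ r * + s - (+ n - + K) * (+ r + + s - + n))    ≤⟨ ℤ.+-monoʳ-≤ (+ s * + K) (ℤ.neg-mono-≤ upper) ⟩
    + s * + K - + a                                              ≡⟨ cong (_- + a) (ℤ.pos-* s K) ⟨
    + (s N.* K) - + a                                            ≡⟨ +m≡+o-+n D+a≡s*K ⟨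
    + D                                                          ∎)
    where
    open ℤ.≤-Reasoning
    identity : ∀ n r s K → (s + K - n) * (n - r) ≡ s * K - (r * s - (n - K) * (r + s - n))
    identity = solve-∀

theorem1p6 : (n r s : ℕ) → .{{NonZero n}} → .{{NonZero r}} → .{{NonZero s}} →
             r N.≤ n → s N.≤ n → (k : ℤ) → (A : Array r s) →
             (∀ i → ((+ s) + k - (+ n) ≤ + rowOnes A i) × (+ rowOnes A i ≤ k)) →
             (∀ j → ((+ r) + k - (+ n) ≤ + colOnes A j) × (+ colOnes A j ≤ k)) →
             ((+ r) + (+ s) - (+ n)) * k ≤ + totalOnes A →
             + totalOnes A ≤ (+ r) * (+ s) - ((+ n) - k) * ((+ r) + (+ s) - (+ n)) →
             Σ (Array (n ∸ r) s) λ B →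
               (∀ j → + colOnes (stack A B) j ≡ k) ×
               (∀ i → ((+ s) + k - (+ n) ≤ + rowOnes (stack A B) i) × (+ rowOnes (stack A B) i ≤ k))
theorem1p6 n N.zero s {{_}} {{()}}
theorem1p6 n (N.suc _) s _ _ -[1+ _ ] A rowsA _ _ _ with proj₂ (rowsA F.zero)
... | ()
theorem1p6 n r@(N.suc _) s r≤n _ (+ K) A rowsA colsA lower upper =
  let (B , colOnes-stack≡K , rowsB) = completion A colOnes≤K n r≤n colOnes≥
                                        (∑deficit-lower {s = s} {K} r≤n ∑deficit upper) (∑deficit-upper r≤n ∑deficit lower)
  in B , cong +_ ∘ colOnes-stack≡K , stack-rows A B RowBounds rowsA (rowBounds ∘ rowsB)
  where
  colOnes≤K : ∀ j → colOnes A j N.≤ K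
  colOnes≤K j = ℤ.drop‿+≤+ (proj₂ (colsA j))
  colOnes≥ : ∀ j → r N.+ K N.≤ n N.+ colOnes A j
  colOnes≥ j = m-n≤o⇒m≤n+o (proj₁ (colsA j))
  ∑deficit : sum (deficit K A) N.+ totalOnes A ≡ s N.* K
  ∑deficit = ∑deficit+totalOnes A colOnes≤K
  RowBounds : ℕ → Set
  RowBounds x = (+ s + + K - + n ≤ + x) × (+ x ≤ + K)
  rowBounds : ∀ {x} → (s N.+ K ∸ n) N.≤ x × x N.≤ K → RowBounds x
  rowBounds (lo≤x , x≤K) = m≤n+o⇒m-n≤o (N.≤-trans (N.m≤n+m∸n (s N.+ K) n) (N.+-monoʳ-≤ n lo≤x)) , +≤+ x≤K
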